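{- Let $f$ be an $(n,m,S)$ zero-difference function from a finite abelian group $(A,+)$ onto a finite abelian group $(B,+)$, let $\lambda=\max_{x\in S}x$, let $\overline{\lambda}=\frac{1}{n-1}\sum_{\alpha\in A\setminus\{0\}}\lambda_\alpha$, and write $n=km+\epsilon$ with $0\le\epsilon<m$. Then $$\lambda\ge\left\lceil\frac{(n-\epsilon)(n+\epsilon-m)}{m(n-1)}+\lambda-\overline{\lambda}\right\rceil.$$ In particular, $\lambda=\frac{(n-\epsilon)(n+\epsilon-m)}{m(n-1)}+\lambda-\overline{\lambda}$ if and only if $r_b=k$ for exactly $m-\epsilon$ elements $b\in B$ and $r_b=k+1$ for the other $\epsilon$ elements, where $r_b=|f^{ -1}(b)|$.
   Context: $\lambda_\alpha=|\{x\in A\mid f(x+\alpha)=f(x)\}|$ for $\alpha\in A\setminus\{0\}$; $f$ is an $(n,m,S)$ zero-difference function if $n=|A|$, $m=|f(A)|$ and $S=\{\lambda_\alpha\mid\alpha\in A\setminus\{0\}\}$. -}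

module Defs where

open import Data.Nat using (ℕ; zero; suc; _+_; _*_; _∸_; _≤_; _⊔_; NonZero; s≤s; z≤n)
open import Data.Nat.Properties using (_≟_)
open import Data.Fin using (Fin)
open import Data.Fin.Properties renaming (_≟_ to _≟ᶠ_)
open import Data.List using (List; length; filter; map; foldr)
open import Data.Nat.ListAction using (sum)
open import Data.Integer using (ℤ; +_) renaming (_*_ to _*ℤ_; _+_ to _+ℤ_; _-_ to _-ℤ_)
open import Data.Rational using (ℚ; _/_; ceiling) renaming (_+_ to _+ℚ_; _-_ to _-ℚ_)
open import Data.List using (allFin) public
open import Relation.Nullary.Decidable using (¬?)

nonzeros : ∀ {n} → Fin n → List (Fin n)
nonzeros {n} 0A = filter (λ α → ¬? (α ≟ᶠ 0A)) (allFin n)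

lamα : ∀ {n m} → (Fin n → Fin n → Fin n) → (Fin n → Fin m) → Fin n → ℕ
lamα {n} _+A_ f α = length (filter (λ x → f (x +A α) ≟ᶠ f x) (allFin n))

lamMax : ∀ {n m} → (Fin n → Fin n → Fin n) → Fin n → (Fin n → Fin m) → ℕ
lamMax _+A_ 0A f = foldr _⊔_ 0 (map (lamα _+A_ f) (nonzeros 0A))

lamSum : ∀ {n m} → (Fin n → Fin n → Fin n) → Fin n → (Fin n → Fin m) → ℕ
lamSum _+A_ 0A f = sum (map (lamα _+A_ f) (nonzeros 0A))

nz : ∀ {n} → 2 ≤ n → NonZero (n ∸ 1)
nz (s≤s (s≤s _)) = _

nzm : ∀ {m n} → Fin m → 2 ≤ n → NonZero (m * (n ∸ 1))
nzm {suc m} {suc (suc n)} _ (s≤s (s≤s _)) = _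

lamBar : ∀ {n m} → (Fin n → Fin n → Fin n) → Fin n → (Fin n → Fin m) → 2 ≤ n → ℚ
lamBar {n} _+A_ 0A f 2≤n = (+ lamSum _+A_ 0A f) / (n ∸ 1)
  where instance _ = nz 2≤n

mainTerm : (n m ε : ℕ) → Fin m → 2 ≤ n → ℚ
mainTerm n m ε b 2≤n =
  (((+ n) -ℤ (+ ε)) *ℤ (((+ n) +ℤ (+ ε)) -ℤ (+ m))) / (m * (n ∸ 1))
  where instance _ = nzm b 2≤n

preimSize : ∀ {n m} → (Fin n → Fin m) → Fin m → ℕ
preimSize {n} f b = length (filter (λ x → f x ≟ᶠ b) (allFin n))

countFibres : ∀ {n m} → (Fin n → Fin m) → ℕ → ℕ
countFibres {n} {m} f t = length (filter (λ b → preimSize f b ≟ t) (allFin m))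

module Submission where

-- Counting the pairs (x, y) with f x = f y once by their difference and once by their common
-- value gives Σ_{α ≠ 0} λ_α + n = Σ_b r_b², where Σ_b r_b = n = km + ε. For natural x,
-- x² = (2k+1)x − k(k+1) + (x−k)(x−k−1), and the last term is non-negative and vanishes exactly
-- for x ∈ {k, k+1}. Summing over b gives (n−ε)(n+ε−m) = m(Σ_{α≠0} λ_α − Δ) with
-- Δ = Σ_b (r_b−k)(r_b−k−1) ≥ 0, so the number inside the ceiling is λ − Δ/(n−1) ≤ λ, with
-- equality iff every r_b ∈ {k, k+1}; as Σ_b r_b = km + ε, that means exactly ε fibres of size k+1.

module FiniteSums where

  open import Data.Nat using (ℕ; zero; suc; _+_; _*_; _∸_; _≤_)
  import Data.Nat.Properties as ℕ
  open import Data.Fin using (Fin; zero; suc)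
  open import Data.Fin.Properties using (suc-injective) renaming (_≟_ to _≟ᶠ_)
  open import Data.Fin.Permutation using (permutation)
  open import Data.List using (length; filter; map; tabulate)
  import Data.Nat.ListAction as List
  open import Data.Empty using (⊥-elim)
  open import Function using (_∘_; _⇔_; mk⇔; Equivalence)
  open import Level using (0ℓ)
  open import Relation.Nullary using (Dec; yes; no)
  open import Relation.Nullary.Decidable using (¬?)
  open import Relation.Unary using (Pred; Decidable)
  open import Relation.Binary.PropositionalEquality
  open import Algebra.Bundles using (Group)
  open import Algebra.Structures using (IsGroup)
  open import Algebra.Properties.Semiring.Sum ℕ.+-*-semiring public
    using (sum; sum-cong-≗; ∑-comm; ∑-distrib-+; sum-permute; *-distribˡ-sum; *-distribʳ-sum)

  𝟙 : ∀ {p} {P : Set p} → Dec P → ℕ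
  𝟙 (yes _) = 1
  𝟙 (no _)  = 0

  𝟙-cong : ∀ {p q} {P : Set p} {Q : Set q} (P? : Dec P) (Q? : Dec Q) → P ⇔ Q → 𝟙 P? ≡ 𝟙 Q?
  𝟙-cong (yes _) (yes _) _   = refl
  𝟙-cong (no _)  (no _)  _   = refl
  𝟙-cong (yes p) (no ¬q) P⇔Q = ⊥-elim (¬q (Equivalence.to P⇔Q p))
  𝟙-cong (no ¬p) (yes q) P⇔Q = ⊥-elim (¬p (Equivalence.from P⇔Q q))

  𝟙-yes : ∀ {p} {P : Set p} (P? : Dec P) → P → 𝟙 P? ≡ 1
  𝟙-yes (yes _) _ = refl
  𝟙-yes (no ¬p) p = ⊥-elim (¬p p)

  𝟙-¬+𝟙 : ∀ {p} {P : Set p} (P? : Dec P) → 𝟙 (¬? P?) + 𝟙 P? ≡ 1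
  𝟙-¬+𝟙 (yes _) = refl
  𝟙-¬+𝟙 (no _)  = refl

  sum-const : ∀ n c → sum {n} (λ _ → c) ≡ n * c
  sum-const zero    c = refl
  sum-const (suc n) c = cong (c +_) (sum-const n c)

  length-filter-tabulate : ∀ {A : Set} {P : Pred A 0ℓ} (P? : Decidable P) {n} (φ : Fin n → A) →
    length (filter P? (tabulate φ)) ≡ sum (λ i → 𝟙 (P? (φ i)))
  length-filter-tabulate P? {zero}  φ = refl
  length-filter-tabulate P? {suc n} φ with P? (φ zero)
  ... | yes _ = cong suc (length-filter-tabulate P? (φ ∘ suc))
  ... | no _  = length-filter-tabulate P? (φ ∘ suc)

  sum-map-filter-tabulate : ∀ {A : Set} {P : Pred A 0ℓ} (P? : Decidable P) {n} (φ : Fin n → A) (g : A → ℕ) →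
    List.sum (map g (filter P? (tabulate φ))) ≡ sum (λ i → 𝟙 (P? (φ i)) * g (φ i))
  sum-map-filter-tabulate P? {zero}  φ g = refl
  sum-map-filter-tabulate P? {suc n} φ g with P? (φ zero)
  ... | yes _ = cong₂ _+_ (sym (ℕ.+-identityʳ _)) (sum-map-filter-tabulate P? (φ ∘ suc) g)
  ... | no _  = sum-map-filter-tabulate P? (φ ∘ suc) g

  sum-𝟙-≟ : ∀ {n} (c : Fin n) (h : Fin n → ℕ) → sum (λ i → 𝟙 (i ≟ᶠ c) * h i) ≡ h c
  sum-𝟙-≟ {suc n} zero h = begin
    h zero + 0 + sum {n} (λ _ → 0) ≡⟨ cong (h zero + 0 +_) (trans (sum-const n 0) (ℕ.*-zeroʳ n)) ⟩
    h zero + 0 + 0                 ≡⟨ trans (ℕ.+-identityʳ _) (ℕ.+-identityʳ _) ⟩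
    h zero                         ∎
    where open ≡-Reasoning
  sum-𝟙-≟ {suc n} (suc c) h = trans
    (sum-cong-≗ {n} (λ i → cong (_* h (suc i))
      (𝟙-cong (suc i ≟ᶠ suc c) (i ≟ᶠ c) (mk⇔ suc-injective (cong suc)))))
    (sum-𝟙-≟ c (h ∘ suc))

  sum-𝟙-≟ˡ : ∀ {n} (c : Fin n) (h : Fin n → ℕ) → sum (λ i → 𝟙 (c ≟ᶠ i) * h i) ≡ h c
  sum-𝟙-≟ˡ {n} c h = trans
    (sum-cong-≗ {n} (λ i → cong (_* h i) (𝟙-cong (c ≟ᶠ i) (i ≟ᶠ c) (mk⇔ sym sym))))
    (sum-𝟙-≟ c h)

  sum-split-at : ∀ {n} (c : Fin n) (g : Fin n → ℕ) →
    sum (λ i → 𝟙 (¬? (i ≟ᶠ c)) * g i) + g c ≡ sum g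
  sum-split-at {n} c g = begin
    sum (λ i → 𝟙 (¬? (i ≟ᶠ c)) * g i) + g c
      ≡⟨ cong (sum (λ i → 𝟙 (¬? (i ≟ᶠ c)) * g i) +_) (sym (sum-𝟙-≟ c g)) ⟩
    sum (λ i → 𝟙 (¬? (i ≟ᶠ c)) * g i) + sum (λ i → 𝟙 (i ≟ᶠ c) * g i)
      ≡⟨ ∑-distrib-+ {n} (λ i → 𝟙 (¬? (i ≟ᶠ c)) * g i) (λ i → 𝟙 (i ≟ᶠ c) * g i) ⟨
    sum (λ i → 𝟙 (¬? (i ≟ᶠ c)) * g i + 𝟙 (i ≟ᶠ c) * g i)
      ≡⟨ sum-cong-≗ {n} (λ i → trans (sym (ℕ.*-distribʳ-+ (g i) (𝟙 (¬? (i ≟ᶠ c))) (𝟙 (i ≟ᶠ c))))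
                                     (trans (cong (_* g i) (𝟙-¬+𝟙 (i ≟ᶠ c))) (ℕ.*-identityˡ (g i)))) ⟩
    sum g ∎
    where open ≡-Reasoning

  sum≡0⇒≡0 : ∀ {n} (g : Fin n → ℕ) → sum g ≡ 0 → ∀ i → g i ≡ 0
  sum≡0⇒≡0 g Σg≡0 zero    = ℕ.m+n≡0⇒m≡0 (g zero) Σg≡0
  sum≡0⇒≡0 g Σg≡0 (suc i) = sum≡0⇒≡0 (g ∘ suc) (ℕ.m+n≡0⇒n≡0 (g zero) Σg≡0) i

  ≡0⇒sum≡0 : ∀ {n} (g : Fin n → ℕ) → (∀ i → g i ≡ 0) → sum g ≡ 0
  ≡0⇒sum≡0 {n} g g≡0 = trans (sum-cong-≗ {n} g≡0) (trans (sum-const n 0) (ℕ.*-zeroʳ n))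

  sum-mono-≡⇒≡ : ∀ {n} (g h : Fin n → ℕ) → (∀ i → g i ≤ h i) → sum g ≡ sum h → ∀ i → g i ≡ h i
  sum-mono-≡⇒≡ {n} g h g≤h Σg≡Σh i =
    ℕ.≤-antisym (g≤h i) (ℕ.m∸n≡0⇒m≤n (sum≡0⇒≡0 (λ j → h j ∸ g j) Σ[h∸g]≡0 i))
    where
    open ≡-Reasoning
    Σ[h∸g]≡0 : sum (λ j → h j ∸ g j) ≡ 0
    Σ[h∸g]≡0 = ℕ.+-cancelʳ-≡ (sum g) _ 0 (begin
      sum (λ j → h j ∸ g j) + sum g ≡⟨ ∑-distrib-+ {n} (λ j → h j ∸ g j) g ⟨
      sum (λ j → h j ∸ g j + g j)   ≡⟨ sum-cong-≗ {n} (λ j → ℕ.m∸n+n≡m (g≤h j)) ⟩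
      sum h                         ≡⟨ Σg≡Σh ⟨
      sum g                         ∎)

  module _ {n} {_∙_ : Fin n → Fin n → Fin n} {e : Fin n} {_⁻¹ : Fin n → Fin n}
           (G : IsGroup _≡_ _∙_ e _⁻¹) where
    private
      group : Group 0ℓ 0ℓ
      group = record { isGroup = G }

    open import Algebra.Properties.Group group using (\\-leftDividesˡ; \\-leftDividesʳ)

    sum-translate : ∀ x (g : Fin n → ℕ) → sum (λ y → g (x ∙ y)) ≡ sum g
    sum-translate x g =
      sym (sum-permute g (permutation (x ∙_) ((x ⁻¹) ∙_) (\\-leftDividesˡ x) (\\-leftDividesʳ x)))

module ZeroDifference where

  open import Data.Nat using (ℕ; _+_; _*_)
  import Data.Nat.Properties as ℕ
  open import Data.Fin using (Fin)
  open import Data.Fin.Properties renaming (_≟_ to _≟ᶠ_)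
  open import Function using (_∘_; id)
  open import Relation.Nullary.Decidable using (¬?)
  open import Relation.Binary.PropositionalEquality
  open import Algebra.Structures using (IsGroup)
  open import Defs
  open FiniteSums

  module _ {n m} (f : Fin n → Fin m) where

    preimSize≡sum-𝟙 : ∀ b → preimSize f b ≡ sum (λ x → 𝟙 (f x ≟ᶠ b))
    preimSize≡sum-𝟙 b = length-filter-tabulate (λ x → f x ≟ᶠ b) id

    sum-∘-fibres : (h : Fin m → ℕ) → sum (h ∘ f) ≡ sum (λ b → preimSize f b * h b)
    sum-∘-fibres h = begin
      sum (h ∘ f)                                 ≡⟨ sum-cong-≗ {n} (λ x → sym (sum-𝟙-≟ˡ (f x) h)) ⟩
      sum (λ x → sum (λ b → 𝟙 (f x ≟ᶠ b) * h b))  ≡⟨ ∑-comm {n} {m} (λ x b → 𝟙 (f x ≟ᶠ b) * h b) ⟩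
      sum (λ b → sum (λ x → 𝟙 (f x ≟ᶠ b) * h b))  ≡⟨ sum-cong-≗ {m} (λ b → sym (*-distribʳ-sum (h b) (λ x → 𝟙 (f x ≟ᶠ b)))) ⟩
      sum (λ b → sum (λ x → 𝟙 (f x ≟ᶠ b)) * h b)  ≡⟨ sum-cong-≗ {m} (λ b → cong (_* h b) (preimSize≡sum-𝟙 b)) ⟨
      sum (λ b → preimSize f b * h b)             ∎
      where open ≡-Reasoning

    sum-preimSize : sum (preimSize f) ≡ n
    sum-preimSize = begin
      sum (preimSize f)                ≡⟨ sum-cong-≗ {m} (λ b → sym (ℕ.*-identityʳ _)) ⟩
      sum (λ b → preimSize f b * 1)    ≡⟨ sum-∘-fibres (λ _ → 1) ⟨
      sum {n} (λ _ → 1)                ≡⟨ sum-const n 1 ⟩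
      n * 1                            ≡⟨ ℕ.*-identityʳ n ⟩
      n                                ∎
      where open ≡-Reasoning

  module _ {n m} {_∙_ : Fin n → Fin n → Fin n} {e : Fin n} {_⁻¹ : Fin n → Fin n}
           (G : IsGroup _≡_ _∙_ e _⁻¹) (f : Fin n → Fin m) where
    open ≡-Reasoning

    lamα≡sum-𝟙 : ∀ α → lamα _∙_ f α ≡ sum (λ x → 𝟙 (f (x ∙ α) ≟ᶠ f x))
    lamα≡sum-𝟙 α = length-filter-tabulate (λ x → f (x ∙ α) ≟ᶠ f x) id

    lamα-e : lamα _∙_ f e ≡ n
    lamα-e = begin
      lamα _∙_ f e                      ≡⟨ lamα≡sum-𝟙 e ⟩
      sum (λ x → 𝟙 (f (x ∙ e) ≟ᶠ f x))  ≡⟨ sum-cong-≗ {n} (λ x → 𝟙-yes (f (x ∙ e) ≟ᶠ f x) (cong f (identityʳ x))) ⟩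
      sum {n} (λ _ → 1)                 ≡⟨ sum-const n 1 ⟩
      n * 1                             ≡⟨ ℕ.*-identityʳ n ⟩
      n                                 ∎
      where open IsGroup G using (identityʳ)

    sum-lamα : sum (lamα _∙_ f) ≡ sum (λ b → preimSize f b * preimSize f b)
    sum-lamα = begin
      sum (lamα _∙_ f)                               ≡⟨ sum-cong-≗ {n} lamα≡sum-𝟙 ⟩
      sum (λ α → sum (λ x → 𝟙 (f (x ∙ α) ≟ᶠ f x)))  ≡⟨ ∑-comm {n} {n} (λ α x → 𝟙 (f (x ∙ α) ≟ᶠ f x)) ⟩
      sum (λ x → sum (λ α → 𝟙 (f (x ∙ α) ≟ᶠ f x)))  ≡⟨ sum-cong-≗ {n} (λ x → sum-translate G x (λ y → 𝟙 (f y ≟ᶠ f x))) ⟩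
      sum (λ x → sum (λ y → 𝟙 (f y ≟ᶠ f x)))        ≡⟨ sum-cong-≗ {n} (λ x → preimSize≡sum-𝟙 f (f x)) ⟨
      sum (preimSize f ∘ f)                          ≡⟨ sum-∘-fibres f (preimSize f) ⟩
      sum (λ b → preimSize f b * preimSize f b)      ∎

    lamSum+n≡sum-preimSize² : lamSum _∙_ e f + n ≡ sum (λ b → preimSize f b * preimSize f b)
    lamSum+n≡sum-preimSize² = begin
      lamSum _∙_ e f + n
        ≡⟨ cong₂ _+_ (sum-map-filter-tabulate (λ α → ¬? (α ≟ᶠ e)) id (lamα _∙_ f)) (sym lamα-e) ⟩
      sum (λ α → 𝟙 (¬? (α ≟ᶠ e)) * lamα _∙_ f α) + lamα _∙_ f e
        ≡⟨ sum-split-at e (lamα _∙_ f) ⟩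
      sum (lamα _∙_ f)
        ≡⟨ sum-lamα ⟩
      sum (λ b → preimSize f b * preimSize f b) ∎

module Deviation where

  open import Data.Nat using (ℕ; zero; suc; _+_; _*_; _∸_; _≤_; _<_; s≤s; z≤n; _≟_; _≤?_)
  import Data.Nat.Properties as ℕ
  open import Data.Nat.Tactic.RingSolver using (solve-∀)
  open import Data.Fin using (Fin)
  open import Data.List using (length; filter; allFin)
  open import Data.Product using (_×_; _,_)
  open import Data.Sum using (_⊎_; inj₁; inj₂)
  open import Data.Empty using (⊥-elim)
  open import Function using (_∘_; id; _⇔_; mk⇔; Equivalence)
  open import Relation.Nullary using (yes; no)
  open import Relation.Binary.PropositionalEquality
  open FiniteSums

  Near : ℕ → ℕ → Set
  Near k x = x ≡ k ⊎ x ≡ suc k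

  -- (x − k)(x − k − 1), written in ℕ: for x ≤ k only the second product can be non-zero,
  -- for x > k only the first.
  deviation : ℕ → ℕ → ℕ
  deviation k x = (x ∸ k) * (x ∸ suc k) + (k ∸ x) * (suc k ∸ x)

  data Position (k x : ℕ) : Set where
    below : ∀ t → k ≡ x + t → Position k x
    above : ∀ t → x ≡ suc k + t → Position k x

  position : ∀ k x → Position k x
  position k x with x ≤? k
  ... | yes x≤k = let t , x+t≡k = ℕ.m≤n⇒∃[o]m+o≡n x≤k in below t (sym x+t≡k)
  ... | no  x≰k = let t , sk+t≡x = ℕ.m≤n⇒∃[o]m+o≡n (ℕ.≰⇒> x≰k) in above t (sym sk+t≡x)

  suc[m+n]∸m≡suc[n] : ∀ m n → suc (m + n) ∸ m ≡ suc n
  suc[m+n]∸m≡suc[n] m n = trans (cong (_∸ m) (sym (ℕ.+-suc m n))) (ℕ.m+n∸m≡n m (suc n))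

  deviation-below : ∀ x t → deviation (x + t) x ≡ t * suc t
  deviation-below x t = cong₂ _+_
    (cong₂ _*_ (ℕ.m≤n⇒m∸n≡0 (ℕ.m≤m+n x t)) (ℕ.m≤n⇒m∸n≡0 (ℕ.m≤n⇒m≤1+n (ℕ.m≤m+n x t))))
    (cong₂ _*_ (ℕ.m+n∸m≡n x t) (suc[m+n]∸m≡suc[n] x t))

  deviation-above : ∀ k t → deviation k (suc k + t) ≡ suc t * t
  deviation-above k t = trans
    (cong₂ _+_ (cong₂ _*_ (suc[m+n]∸m≡suc[n] k t) (ℕ.m+n∸m≡n k t))
               (cong₂ _*_ (ℕ.m≤n⇒m∸n≡0 (ℕ.m≤n⇒m≤1+n (ℕ.m≤m+n k t))) (ℕ.m≤n⇒m∸n≡0 (ℕ.m≤m+n (suc k) t))))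
    (ℕ.+-identityʳ _)

  square≡deviation : ∀ k x → x * x + k * suc k ≡ (k + suc k) * x + deviation k x
  square≡deviation k x with position k x
  ... | below t refl = trans (identity x t) (cong (((x + t) + suc (x + t)) * x +_) (sym (deviation-below x t)))
    where identity : ∀ x t → x * x + (x + t) * suc (x + t) ≡ ((x + t) + suc (x + t)) * x + t * suc t
          identity = solve-∀
  ... | above t refl = trans (identity k t) (cong ((k + suc k) * (suc k + t) +_) (sym (deviation-above k t)))
    where identity : ∀ k t → (suc k + t) * (suc k + t) + k * suc k ≡ (k + suc k) * (suc k + t) + suc t * t
          identity = solve-∀

  deviation≡0⇔Near : ∀ k x → deviation k x ≡ 0 ⇔ Near k x
  deviation≡0⇔Near k x = mk⇔ (to (position k x)) from
    where
    to : Position k x → deviation k x ≡ 0 → Near k x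
    to (below zero    refl) _ = inj₁ (sym (ℕ.+-identityʳ x))
    to (below (suc t) refl) e with trans (sym (deviation-below x (suc t))) e
    ... | ()
    to (above zero    refl) _ = inj₂ (ℕ.+-identityʳ (suc k))
    to (above (suc t) refl) e with trans (sym (deviation-above k (suc t))) e
    ... | ()
    from : Near k x → deviation k x ≡ 0
    from (inj₁ refl) = subst (λ y → deviation y x ≡ 0) (ℕ.+-identityʳ x) (deviation-below x 0)
    from (inj₂ refl) = subst (λ y → deviation k y ≡ 0) (ℕ.+-identityʳ (suc k)) (deviation-above k 0)

  module _ {m : ℕ} (k : ℕ) (r : Fin m → ℕ) where

    sum-squares : sum (λ b → r b * r b) + m * (k * suc k) ≡ (k + suc k) * sum r + sum (deviation k ∘ r)
    sum-squares = begin
      sum (λ b → r b * r b) + m * (k * suc k)          ≡⟨ cong (sum (λ b → r b * r b) +_) (sum-const m (k * suc k)) ⟨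
      sum (λ b → r b * r b) + sum {m} (λ _ → k * suc k) ≡⟨ ∑-distrib-+ {m} (λ b → r b * r b) (λ _ → k * suc k) ⟨
      sum (λ b → r b * r b + k * suc k)                 ≡⟨ sum-cong-≗ {m} (λ b → square≡deviation k (r b)) ⟩
      sum (λ b → (k + suc k) * r b + deviation k (r b)) ≡⟨ ∑-distrib-+ {m} (λ b → (k + suc k) * r b) (deviation k ∘ r) ⟩
      sum (λ b → (k + suc k) * r b) + sum (deviation k ∘ r) ≡⟨ cong (_+ sum (deviation k ∘ r)) (*-distribˡ-sum (k + suc k) r) ⟨
      (k + suc k) * sum r + sum (deviation k ∘ r)       ∎
      where open ≡-Reasoning

    sum-deviation≡0⇔Near : sum (deviation k ∘ r) ≡ 0 ⇔ (∀ b → Near k (r b))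
    sum-deviation≡0⇔Near = mk⇔
      (λ e b → Equivalence.to (deviation≡0⇔Near k (r b)) (sum≡0⇒≡0 (deviation k ∘ r) e b))
      (λ near → ≡0⇒sum≡0 (deviation k ∘ r) (λ b → Equivalence.from (deviation≡0⇔Near k (r b)) (near b)))

  𝟙≟+𝟙≟suc≤1 : ∀ k x → 𝟙 (x ≟ k) + 𝟙 (x ≟ suc k) ≤ 1
  𝟙≟+𝟙≟suc≤1 k x with x ≟ k | x ≟ suc k
  ... | yes refl | yes x≡sx = ⊥-elim (ℕ.1+n≢n (sym x≡sx))
  ... | yes _    | no _     = s≤s z≤n
  ... | no _     | yes _    = s≤s z≤n
  ... | no _     | no _     = z≤n

  𝟙≟+𝟙≟suc≡1⇔Near : ∀ k x → 𝟙 (x ≟ k) + 𝟙 (x ≟ suc k) ≡ 1 ⇔ Near k x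
  𝟙≟+𝟙≟suc≡1⇔Near k x = mk⇔ to from
    where
    to : 𝟙 (x ≟ k) + 𝟙 (x ≟ suc k) ≡ 1 → Near k x
    to e with x ≟ k | x ≟ suc k
    ... | yes x≡k | _       = inj₁ x≡k
    ... | no _    | yes x≡sk = inj₂ x≡sk
    ... | no _    | no _    with e
    ... | ()
    from : Near k x → 𝟙 (x ≟ k) + 𝟙 (x ≟ suc k) ≡ 1
    from (inj₁ refl) with x ≟ x | x ≟ suc x
    ... | yes _ | no _      = refl
    ... | no x≢x | _        = ⊥-elim (x≢x refl)
    ... | _     | yes x≡sx = ⊥-elim (ℕ.1+n≢n (sym x≡sx))
    from (inj₂ refl) with suc k ≟ k | suc k ≟ suc k
    ... | no _  | yes _      = refl
    ... | yes sk≡k | _       = ⊥-elim (ℕ.1+n≢n sk≡k)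
    ... | _     | no sk≢sk   = ⊥-elim (sk≢sk refl)

  Near⇒≡+𝟙≟suc : ∀ k x → Near k x → x ≡ k + 𝟙 (x ≟ suc k)
  Near⇒≡+𝟙≟suc k x (inj₁ refl) with x ≟ suc x
  ... | no _     = sym (ℕ.+-identityʳ x)
  ... | yes x≡sx = ⊥-elim (ℕ.1+n≢n (sym x≡sx))
  Near⇒≡+𝟙≟suc k x (inj₂ refl) with suc k ≟ suc k
  ... | yes _     = sym (ℕ.+-comm k 1)
  ... | no sk≢sk  = ⊥-elim (sk≢sk refl)

  count : ∀ {m} → (Fin m → ℕ) → ℕ → ℕ
  count {m} r t = length (filter (λ b → r b ≟ t) (allFin m))

  count≡sum-𝟙 : ∀ {m} (r : Fin m → ℕ) t → count r t ≡ sum (λ b → 𝟙 (r b ≟ t))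
  count≡sum-𝟙 r t = length-filter-tabulate (λ b → r b ≟ t) id

  module _ {m : ℕ} (k ε : ℕ) (r : Fin m → ℕ) (Σr≡ : sum r ≡ k * m + ε) (ε<m : ε < m) where
    open ≡-Reasoning

    private
      count+count-suc : count r k + count r (suc k) ≡ sum (λ b → 𝟙 (r b ≟ k) + 𝟙 (r b ≟ suc k))
      count+count-suc = trans (cong₂ _+_ (count≡sum-𝟙 r k) (count≡sum-𝟙 r (suc k)))
                              (sym (∑-distrib-+ {m} (λ b → 𝟙 (r b ≟ k)) (λ b → 𝟙 (r b ≟ suc k))))

      sum-1 : sum {m} (λ _ → 1) ≡ m
      sum-1 = trans (sum-const m 1) (ℕ.*-identityʳ m)

    Near⇔counts : (∀ b → Near k (r b)) ⇔ (count r k ≡ m ∸ ε × count r (suc k) ≡ ε)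
    Near⇔counts = mk⇔ to from
      where
      to : (∀ b → Near k (r b)) → count r k ≡ m ∸ ε × count r (suc k) ≡ ε
      to near = count-k≡ , count-suc-k≡
        where
        counts≡m : count r k + count r (suc k) ≡ m
        counts≡m = begin
          count r k + count r (suc k)                ≡⟨ count+count-suc ⟩
          sum (λ b → 𝟙 (r b ≟ k) + 𝟙 (r b ≟ suc k))  ≡⟨ sum-cong-≗ {m} (λ b → Equivalence.from (𝟙≟+𝟙≟suc≡1⇔Near k (r b)) (near b)) ⟩
          sum {m} (λ _ → 1)                          ≡⟨ sum-1 ⟩
          m                                          ∎
        count-suc-k≡ : count r (suc k) ≡ ε
        count-suc-k≡ = sym (ℕ.+-cancelˡ-≡ (k * m) ε (count r (suc k)) (begin
          k * m + ε                            ≡⟨ Σr≡ ⟨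
          sum r                                ≡⟨ sum-cong-≗ {m} (λ b → Near⇒≡+𝟙≟suc k (r b) (near b)) ⟩
          sum (λ b → k + 𝟙 (r b ≟ suc k))                       ≡⟨ ∑-distrib-+ {m} (λ _ → k) (λ b → 𝟙 (r b ≟ suc k)) ⟩
          sum {m} (λ _ → k) + sum (λ b → 𝟙 (r b ≟ suc k))      ≡⟨ cong₂ _+_ (trans (sum-const m k) (ℕ.*-comm m k)) (sym (count≡sum-𝟙 r (suc k))) ⟩
          k * m + count r (suc k)                               ∎))
        count-k≡ : count r k ≡ m ∸ ε
        count-k≡ = trans (sym (ℕ.m+n∸n≡m (count r k) (count r (suc k)))) (cong₂ _∸_ counts≡m count-suc-k≡)
      -- Each summand of count r k + count r (suc k) is at most 1 and the total is m, so every summand is 1.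
      from : count r k ≡ m ∸ ε × count r (suc k) ≡ ε → ∀ b → Near k (r b)
      from (count-k≡ , count-suc-k≡) b = Equivalence.to (𝟙≟+𝟙≟suc≡1⇔Near k (r b))
        (sum-mono-≡⇒≡ (λ b → 𝟙 (r b ≟ k) + 𝟙 (r b ≟ suc k)) (λ _ → 1) (λ b → 𝟙≟+𝟙≟suc≤1 k (r b)) Σ≡m b)
        where
        Σ≡m : sum (λ b → 𝟙 (r b ≟ k) + 𝟙 (r b ≟ suc k)) ≡ sum {m} (λ _ → 1)
        Σ≡m = begin
          sum (λ b → 𝟙 (r b ≟ k) + 𝟙 (r b ≟ suc k)) ≡⟨ count+count-suc ⟨
          count r k + count r (suc k)               ≡⟨ cong₂ _+_ count-k≡ count-suc-k≡ ⟩
          m ∸ ε + ε                                 ≡⟨ ℕ.m∸n+n≡m (ℕ.<⇒≤ ε<m) ⟩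
          m                                         ≡⟨ sum-1 ⟨
          sum {m} (λ _ → 1)                         ∎

module Fractions where

  open import Data.Nat as ℕ using (ℕ; suc; NonZero)
  open import Data.Integer using (ℤ; +_; -[1+_]; _+_; _*_; _-_; -_; 0ℤ; 1ℤ; _≤_; _<_; ∣_∣; _/ℕ_)
    renaming (_/_ to _/ℤ_; suc to sucℤ)
  import Data.Integer.Properties as ℤP
  open import Data.Integer.DivMod using (div-pos-is-/ℕ; n<s[n/ℕd]*d)
  open import Data.Integer.Tactic.RingSolver using (solve-∀)
  open import Data.Rational using (mkℚ; _/_; ceiling; toℚᵘ)
    renaming (_≤_ to _≤ℚ_; _+_ to _+ℚ_; _-_ to _-ℚ_; -_ to -ℚ_)
  import Data.Rational.Properties as ℚP
  open import Data.Rational.Unnormalised using (mkℚᵘ; *≤*; *≡*) renaming (_/_ to _/ᵘ_; _≃_ to _≃ᵘ_)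
  import Data.Rational.Unnormalised.Properties as ℚᵘP
  open import Data.Nat.Coprimality using (Coprime)
  open import Function using (_⇔_; mk⇔; Equivalence)
  open import Relation.Binary.PropositionalEquality
  open import Algebra.Properties.AbelianGroup ℚP.+-0-abelianGroup using (xyx⁻¹≈y; //-rightDividesˡ; //-rightDividesʳ)

  numerator-identity : ∀ (n k m ε S Δ : ℤ) → n ≡ k * m + ε →
    S + n + m * (k * (1ℤ + k)) ≡ (k + (1ℤ + k)) * n + Δ →
    (n - ε) * ((n + ε) - m) ≡ m * (S - Δ)
  numerator-identity _ k m ε S Δ refl squares = begin
    (n - ε) * ((n + ε) - m)                                         ≡⟨ expand k m ε Δ ⟩
    m * ((k + (1ℤ + k)) * n + Δ - n - m * (k * (1ℤ + k)) - Δ)      ≡⟨ cong (λ z → m * (z - n - m * (k * (1ℤ + k)) - Δ)) squares ⟨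
    m * (S + n + m * (k * (1ℤ + k)) - n - m * (k * (1ℤ + k)) - Δ)  ≡⟨ cong (λ z → m * (z - Δ)) (cancel S n (m * (k * (1ℤ + k)))) ⟩
    m * (S - Δ)                                                     ∎
    where
    open ≡-Reasoning
    n = k * m + ε
    expand : ∀ k m ε Δ → ((k * m + ε) - ε) * (((k * m + ε) + ε) - m)
           ≡ m * ((k + (1ℤ + k)) * (k * m + ε) + Δ - (k * m + ε) - m * (k * (1ℤ + k)) - Δ)
    expand = solve-∀
    cancel : ∀ S n c → S + n + c - n - c ≡ S
    cancel = solve-∀

  numerator-identityℕ : ∀ n k m ε S Δ → n ≡ k ℕ.* m ℕ.+ ε →
    S ℕ.+ n ℕ.+ m ℕ.* (k ℕ.* suc k) ≡ (k ℕ.+ suc k) ℕ.* n ℕ.+ Δ →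
    (+ n - + ε) * ((+ n + + ε) - + m) ≡ + m * (+ S - + Δ)
  numerator-identityℕ n k m ε S Δ n≡ squares =
    numerator-identity (+ n) (+ k) (+ m) (+ ε) (+ S) (+ Δ)
      (trans (cong +_ n≡) castⁿ) (trans (sym castˡ) (trans (cong +_ squares) castʳ))
    where
    open ℤP using (pos-+; pos-*)
    +suc : + suc k ≡ 1ℤ + + k
    +suc = pos-+ 1 k
    castⁿ : + (k ℕ.* m ℕ.+ ε) ≡ + k * + m + + ε
    castⁿ = trans (pos-+ (k ℕ.* m) ε) (cong (_+ + ε) (pos-* k m))
    castˡ : + (S ℕ.+ n ℕ.+ m ℕ.* (k ℕ.* suc k)) ≡ + S + + n + + m * (+ k * (1ℤ + + k))
    castˡ = trans (pos-+ (S ℕ.+ n) _) (cong₂ _+_ (pos-+ S n)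
      (trans (pos-* m _) (cong (+ m *_) (trans (pos-* k (suc k)) (cong (+ k *_) +suc)))))
    castʳ : + ((k ℕ.+ suc k) ℕ.* n ℕ.+ Δ) ≡ (+ k + (1ℤ + + k)) * + n + + Δ
    castʳ = trans (pos-+ _ Δ) (cong (_+ + Δ)
      (trans (pos-* (k ℕ.+ suc k) n) (cong (_* + n) (trans (pos-+ k (suc k)) (cong (λ z → + k + z) +suc)))))

  toℚᵘ-/ : ∀ i n .{{_ : NonZero n}} → toℚᵘ (i / n) ≃ᵘ i /ᵘ n
  toℚᵘ-/ i (suc n) = ℚP.toℚᵘ-fromℚᵘ (mkℚᵘ i n)

  *≤*⇒/≤/ : ∀ i j c d .{{_ : NonZero c}} .{{_ : NonZero d}} → i * + d ≤ j * + c → i / c ≤ℚ j / d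
  *≤*⇒/≤/ i j c@(suc _) d@(suc _) h = ℚP.toℚᵘ-cancel-≤
    (ℚᵘP.≤-respˡ-≃ (ℚᵘP.≃-sym (toℚᵘ-/ i c)) (ℚᵘP.≤-respʳ-≃ (ℚᵘP.≃-sym (toℚᵘ-/ j d)) (*≤* h)))

  /≡/⇔*≡* : ∀ i j c d .{{_ : NonZero c}} .{{_ : NonZero d}} → i / c ≡ j / d ⇔ i * + d ≡ j * + c
  /≡/⇔*≡* i j c@(suc _) d@(suc _) = mk⇔
    (λ e → ℚᵘP.drop-*≡* (ℚᵘP.≃-trans (ℚᵘP.≃-sym (toℚᵘ-/ i c)) (ℚᵘP.≃-trans (ℚP.toℚᵘ-cong e) (toℚᵘ-/ j d))))
    (λ e → ℚP.toℚᵘ-injective (ℚᵘP.≃-trans (toℚᵘ-/ i c) (ℚᵘP.≃-trans (*≡* e) (ℚᵘP.≃-sym (toℚᵘ-/ j d)))))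

  *-cancelˡ-/ : ∀ m i d .{{_ : NonZero d}} .{{_ : NonZero (m ℕ.* d)}} → (+ m * i) / (m ℕ.* d) ≡ i / d
  *-cancelˡ-/ m i d = Equivalence.from (/≡/⇔*≡* (+ m * i) i (m ℕ.* d) d)
    (trans (rearrange (+ m) i (+ d)) (cong (i *_) (sym (ℤP.pos-* m d))))
    where
    rearrange : ∀ m i d → (m * i) * d ≡ i * (m * d)
    rearrange = solve-∀

  [i-n]/d≤i/d : ∀ i n d .{{_ : NonZero d}} → (i - + n) / d ≤ℚ i / d
  [i-n]/d≤i/d i n d = *≤*⇒/≤/ (i - + n) i d d (ℤP.*-monoʳ-≤-nonNeg (+ d) (ℤP.i-j≤i i (+ n)))

  [i-n]/d≡i/d⇔n≡0 : ∀ i n d .{{_ : NonZero d}} → (i - + n) / d ≡ i / d ⇔ n ≡ 0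
  [i-n]/d≡i/d⇔n≡0 i n d = mk⇔
    (λ e → ℤP.+-injective (+n≡0 (ℤP.*-cancelʳ-≡ (i - + n) i (+ d) (Equivalence.to (/≡/⇔*≡* (i - + n) i d d) e))))
    (λ { refl → cong (_/ d) (ℤP.+-identityʳ i) })
    where
    +n≡0 : i - + n ≡ i → + n ≡ 0ℤ
    +n≡0 e = begin
      + n             ≡⟨ identity i (+ n) ⟩
      i - (i - + n)   ≡⟨ cong (λ z → i - z) e ⟩
      i - i           ≡⟨ ℤP.+-inverseʳ i ⟩
      0ℤ              ∎
      where open ≡-Reasoning
            identity : ∀ i j → j ≡ i - (i - j)
            identity = solve-∀

  i*d≤j⇒i≤j/d : ∀ i j d → i * + suc d ≤ j → i ≤ j /ℤ + suc d
  i*d≤j⇒i≤j/d i j d i*d≤j = subst (i ≤_) q≡j/d (subst (i ≤_) (ℤP.pred-suc q) (ℤP.i<j⇒i≤pred[j] i<1+q))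
    where
    q = j /ℕ suc d
    q≡j/d : q ≡ j /ℤ + suc d
    q≡j/d = sym (div-pos-is-/ℕ j (suc d))
    i<1+q : i < sucℤ q
    i<1+q = ℤP.*-cancelʳ-<-nonNeg (+ suc d) (ℤP.≤-<-trans i*d≤j (n<s[n/ℕd]*d j (suc d)))

  ceiling-mkℚ : ∀ a d .(c : Coprime (∣ a ∣) (suc d)) → ceiling (mkℚ a d c) ≡ - ((- a) /ℤ + suc d)
  ceiling-mkℚ (+ 0)      d c = refl
  ceiling-mkℚ (+ suc _)  d c = refl
  ceiling-mkℚ -[1+ _ ]   d c = refl

  ceiling-≤ : ∀ p z → p ≤ℚ z / 1 → ceiling p ≤ z
  ceiling-≤ (mkℚ a d c) z p≤z = subst (_≤ z) (sym (ceiling-mkℚ a d c))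
    (subst (- ((- a) /ℤ + suc d) ≤_) (ℤP.neg-involutive z) (ℤP.neg-mono-≤ (i*d≤j⇒i≤j/d (- z) (- a) d -z*d≤-a)))
    where
    a≤z*d : a * + 1 ≤ z * + suc d
    a≤z*d = ℚᵘP.drop-*≤* (ℚᵘP.≤-respʳ-≃ (toℚᵘ-/ z 1) (ℚP.toℚᵘ-mono-≤ p≤z))
    -z*d≤-a : - z * + suc d ≤ - a
    -z*d≤-a = subst₂ _≤_ (ℤP.neg-distribˡ-* z (+ suc d)) (cong -_ (ℤP.*-identityʳ a)) (ℤP.neg-mono-≤ a≤z*d)

  p≤r⇒[p+q]-r≤q : ∀ {p r} q → p ≤ℚ r → (p +ℚ q) -ℚ r ≤ℚ q
  p≤r⇒[p+q]-r≤q {p} {r} q p≤r = subst ((p +ℚ q) -ℚ r ≤ℚ_) (xyx⁻¹≈y r q) (ℚP.+-monoˡ-≤ (-ℚ r) (ℚP.+-monoˡ-≤ q p≤r))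

  q≡[p+q]-r⇔p≡r : ∀ p q r → q ≡ (p +ℚ q) -ℚ r ⇔ p ≡ r
  q≡[p+q]-r⇔p≡r p q r = mk⇔ to (λ { refl → sym (xyx⁻¹≈y p q) })
    where
    open ≡-Reasoning
    to : q ≡ (p +ℚ q) -ℚ r → p ≡ r
    to e = begin
      p              ≡⟨ //-rightDividesʳ q p ⟨
      (p +ℚ q) -ℚ q  ≡⟨ cong (_-ℚ q) p+q≡r+q ⟩
      (r +ℚ q) -ℚ q  ≡⟨ //-rightDividesʳ q r ⟩
      r              ∎
      where
      p+q≡r+q : p +ℚ q ≡ r +ℚ q
      p+q≡r+q = begin
        p +ℚ q                ≡⟨ //-rightDividesˡ r (p +ℚ q) ⟨
        ((p +ℚ q) -ℚ r) +ℚ r  ≡⟨ cong (_+ℚ r) e ⟨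
        q +ℚ r                ≡⟨ ℚP.+-comm q r ⟩
        r +ℚ q                ∎

open import Defs
open import Data.Nat using (ℕ; suc; _+_; _*_; _∸_; _≤_; _<_)
open import Data.Fin using (Fin)
open import Data.Product using (_×_; _,_)
open import Data.Integer using (+_; _-_) renaming (_≤_ to _≤ℤ_)
open import Data.Rational using (ceiling; _/_) renaming (_+_ to _+ℚ_; _-_ to _-ℚ_; _≤_ to _≤ℚ_)
open import Algebra.Structures using (IsAbelianGroup)
open import Function using (_∘_)
open import Function.Bundles using (_⇔_)
open import Function.Definitions using (Surjective)
open import Function.Properties.Equivalence using () renaming (trans to infixr 5 _⟨⇔⟩_)
open import Relation.Binary.PropositionalEquality using (_≡_; sym; trans; cong; subst; module ≡-Reasoning)
open FiniteSums using (sum)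
open ZeroDifference
open Deviation
open Fractions

module MainTerm {n m : ℕ} (k ε S Δ : ℕ) (b : Fin m) (2≤n : 2 ≤ n)
                (n≡ : n ≡ k * m + ε) (squares : S + n + m * (k * suc k) ≡ (k + suc k) * n + Δ) where
  private instance
    n-1≢0    = nz 2≤n
    m[n-1]≢0 = nzm b 2≤n

  mainTerm≡ : mainTerm n m ε b 2≤n ≡ (+ S - + Δ) / (n ∸ 1)
  mainTerm≡ = trans (cong (_/ (m * (n ∸ 1))) (numerator-identityℕ n k m ε S Δ n≡ squares)) (*-cancelˡ-/ m (+ S - + Δ) (n ∸ 1))

  mainTerm≤ : mainTerm n m ε b 2≤n ≤ℚ + S / (n ∸ 1)
  mainTerm≤ = subst (_≤ℚ + S / (n ∸ 1)) (sym mainTerm≡) ([i-n]/d≤i/d (+ S) Δ (n ∸ 1))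

  mainTerm≡⇔Δ≡0 : mainTerm n m ε b 2≤n ≡ + S / (n ∸ 1) ⇔ Δ ≡ 0
  mainTerm≡⇔Δ≡0 = subst (λ t → t ≡ + S / (n ∸ 1) ⇔ Δ ≡ 0) (sym mainTerm≡) ([i-n]/d≡i/d⇔n≡0 (+ S) Δ (n ∸ 1))

lemma2 : (n m : ℕ)
    → (_+A_ : Fin n → Fin n → Fin n) (0A : Fin n) (-A_ : Fin n → Fin n)
    → IsAbelianGroup _≡_ _+A_ 0A -A_
    → (_+B_ : Fin m → Fin m → Fin m) (0B : Fin m) (-B_ : Fin m → Fin m)
    → IsAbelianGroup _≡_ _+B_ 0B -B_
    → (f : Fin n → Fin m) → Surjective _≡_ _≡_ f
    → (2≤n : 2 ≤ n)
    → (k ε : ℕ) → n ≡ k * m + ε → ε < m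
    → (ceiling ((mainTerm n m ε 0B 2≤n +ℚ (+ lamMax _+A_ 0A f / 1)) -ℚ lamBar _+A_ 0A f 2≤n)
        ≤ℤ (+ lamMax _+A_ 0A f))
      × (((+ lamMax _+A_ 0A f / 1)
          ≡ ((mainTerm n m ε 0B 2≤n +ℚ (+ lamMax _+A_ 0A f / 1)) -ℚ lamBar _+A_ 0A f 2≤n))
        ⇔ ((countFibres f k ≡ m ∸ ε) × (countFibres f (suc k) ≡ ε)))
lemma2 n m _+A_ 0A -A_ G _ 0B _ _ f _ 2≤n k ε n≡ ε<m =
  ceiling-≤ _ (+ L) (p≤r⇒[p+q]-r≤q (+ L / 1) mainTerm≤) ,
  q≡[p+q]-r⇔p≡r _ (+ L / 1) _ ⟨⇔⟩ mainTerm≡⇔Δ≡0 ⟨⇔⟩ sum-deviation≡0⇔Near k r ⟨⇔⟩ Near⇔counts k ε r Σr≡ ε<m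
  where
  L = lamMax _+A_ 0A f
  r = preimSize f
  Δ = sum (deviation k ∘ r)
  Σr≡ : sum r ≡ k * m + ε
  Σr≡ = trans (sum-preimSize f) n≡
  squares : lamSum _+A_ 0A f + n + m * (k * suc k) ≡ (k + suc k) * n + Δ
  squares = begin
    lamSum _+A_ 0A f + n + m * (k * suc k)       ≡⟨ cong (_+ m * (k * suc k)) (lamSum+n≡sum-preimSize² (IsAbelianGroup.isGroup G) f) ⟩
    sum (λ b → r b * r b) + m * (k * suc k)      ≡⟨ sum-squares k r ⟩
    (k + suc k) * sum r + Δ                      ≡⟨ cong (λ s → (k + suc k) * s + Δ) (sum-preimSize f) ⟩
    (k + suc k) * n + Δ                          ∎
    where open ≡-Reasoning
  open MainTerm k ε (lamSum _+A_ 0A f) Δ 0B 2≤n n≡ squares
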